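{- Let $f$ be the function defined in the context. For every integer $k \geq 0$ we have $f(k+1) \leq f(k)+f(\lfloor k/2 \rfloor)$.
   Context: All graphs are finite and simple. For a positive integer $k$, $f(k)$ denotes the maximum possible chromatic number of a graph whose edge set can be partitioned into at most $k$ complete bipartite graphs (i.e., $E(G)$ is a disjoint union of the edge sets of at most $k$ complete bipartite subgraphs of $G$). By convention $f(0)=1$. -}

module Defs where

open import Data.Nat using (ℕ; _≤_)
open import Data.Fin using (Fin)
open import Data.Bool using (Bool; true; false)
open import Data.Product using (Σ; ∃; _×_)
open import Data.Sum using (_⊎_)
open import Relation.Binary.PropositionalEquality using (_≡_; _≢_)

record Graph : Set where
  field
    n      : ℕ
    adj    : Fin n → Fin n → Bool
    sym    : ∀ u v → adj u v ≡ adj v u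
    irrefl : ∀ v → adj v v ≡ false

open Graph public

-- A complete bipartite subgraph of G with sides A and B (given as
-- characteristic functions): every a ∈ A is adjacent in G to every b ∈ B.
-- (A ∩ B = ∅ is forced by irreflexivity whenever A, B are nonempty.)
record Biclique (G : Graph) : Set where
  field
    A        : Fin (n G) → Bool
    B        : Fin (n G) → Bool
    complete : ∀ a b → A a ≡ true → B b ≡ true → adj G a b ≡ true

open Biclique public

Covers : {G : Graph} → Biclique G → Fin (n G) → Fin (n G) → Set
Covers β u v = (A β u ≡ true × B β v ≡ true) ⊎ (A β v ≡ true × B β u ≡ true)

record BicliquePartition (G : Graph) (m : ℕ) : Set where
  field
    bic    : Fin m → Biclique G
    cover  : ∀ u v → adj G u v ≡ true → Σ (Fin m) (λ i → Covers (bic i) u v)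
    unique : ∀ u v (i j : Fin m) → Covers (bic i) u v → Covers (bic j) u v → i ≡ j

HasPartitionAtMost : Graph → ℕ → Set
HasPartitionAtMost G k = ∃ λ m → m ≤ k × BicliquePartition G m

Colorable : Graph → ℕ → Set
Colorable G c = ∃ λ (col : Fin (n G) → Fin c) →
  ∀ u v → adj G u v ≡ true → col u ≢ col v

IsChromaticNumber : Graph → ℕ → Set
IsChromaticNumber G c = Colorable G c × (∀ d → Colorable G d → c ≤ d)

IsF : ℕ → ℕ → Set
IsF k m =
  (∃ λ G → HasPartitionAtMost G k × IsChromaticNumber G m) ×
  (∀ G → HasPartitionAtMost G k → ∀ c → IsChromaticNumber G c → c ≤ m)

-- Let β₀ = (A₀, B₀) be one biclique of a partition of E(G) into k + 1 bicliques. Every edge of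
-- β₀ joins A₀ to B₀, so neither A₀ nor its complement contains an edge of β₀, and the same holds
-- for B₀. The remaining k bicliques therefore partition the edges of G[V ∖ A₀], while the edges
-- of G[A₀] are partitioned by those bicliques both of whose sides meet A₀. No biclique βᵢ can have
-- both sides meeting A₀ and both sides meeting B₀: for a ∈ Aᵢ ∩ A₀ and b ∈ Bᵢ ∩ B₀ the edge ab would
-- lie in βᵢ and in β₀. So for X = A₀ or X = B₀ at most ⌊k/2⌋ bicliques partition G[X], and
-- colouring G[X] and G[V ∖ X] with disjoint palettes gives χ(G) ≤ f(⌊k/2⌋) + f(k).
module Submission where

open import Defs
open import Data.Nat using (ℕ; zero; suc; _+_; _*_; _/_; _≤_; _<_; z≤n; s≤s; _≤?_)
open import Data.Nat.Properties
  using (module ≤-Reasoning; ≤-reflexive; ≤-trans; ≤-total; +-monoˡ-≤; +-monoʳ-≤; +-identityʳ; *-comm; ≮⇒≥)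
open import Data.Nat.DivMod using (m*n/n≡m; /-monoˡ-≤)
open import Data.Nat.Induction using (<-rec)
open import Data.Fin using (Fin; zero; suc; splitAt; join; inject≤)
open import Data.Fin.Properties using (0≢1+n; suc-injective; injective⇒≤; inject≤-injective; any?; +↔⊎)
open import Data.Bool using (Bool; true)
open import Data.Bool.Properties using () renaming (_≟_ to _≟ᵇ_)
open import Data.Product using (∃; ∃₂; _×_; _,_; proj₂)
open import Data.Sum using (_⊎_; inj₁; inj₂; [_,_])
open import Data.Sum.Properties using (inj₁-injective; inj₂-injective)
open import Data.Empty using (⊥-elim)
open import Function using (_∘_; id; Injective; Injection)
open import Function.Properties.Inverse using (↔⇒↣; ↔-sym)
open import Level using (Level; 0ℓ)
open import Relation.Nullary using (¬_; Dec; yes; no; _×-dec_)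
open import Relation.Nullary.Decidable using (decidable-stable)
open import Relation.Unary using (Pred; Decidable; ∁; ∅; _⊥_; _≬_)
open import Relation.Unary.Properties using (∁?; ∅?; _∩?_)
open import Relation.Binary.PropositionalEquality as ≡ using (_≡_; _≢_; refl; cong; subst₂)

open BicliquePartition

private
  variable
    ℓ : Level
    m : ℕ

x+x≤k⇒x≤k/2 : ∀ {x k} → x + x ≤ k → x ≤ k / 2
x+x≤k⇒x≤k/2 {x} {k} x+x≤k = begin
  x          ≡⟨ ≡.sym (m*n/n≡m x 2) ⟩
  x * 2 / 2  ≤⟨ /-monoˡ-≤ 2 (≤-trans (≤-reflexive x*2≡x+x) x+x≤k) ⟩
  k / 2      ∎
  where
  open ≤-Reasoning
  x*2≡x+x : x * 2 ≡ x + x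
  x*2≡x+x = ≡.trans (*-comm x 2) (cong (x +_) (+-identityʳ x))

x+y≤k⇒x≤k/2⊎y≤k/2 : ∀ {x y k} → x + y ≤ k → x ≤ k / 2 ⊎ y ≤ k / 2
x+y≤k⇒x≤k/2⊎y≤k/2 {x} {y} x+y≤k with ≤-total x y
... | inj₁ x≤y = inj₁ (x+x≤k⇒x≤k/2 (≤-trans (+-monoʳ-≤ x x≤y) x+y≤k))
... | inj₂ y≤x = inj₂ (x+x≤k⇒x≤k/2 (≤-trans (+-monoˡ-≤ y y≤x) x+y≤k))

¬¬-least : {P : Pred ℕ ℓ} {n : ℕ} → P n → ¬ ¬ ∃ λ m → P m × ∀ k → P k → m ≤ k
¬¬-least {P = P} {n} pn no-least = <-rec (λ m → ¬ P m) not-least n pn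
  where
  not-least : ∀ m → (∀ {k} → k < m → ¬ P k) → ¬ P m
  not-least m none-below pm = no-least (m , pm , λ k pk → ≮⇒≥ (λ k<m → none-below k<m pk))

record Enumeration (P : Pred (Fin m) ℓ) : Set ℓ where
  field
    size            : ℕ
    embed           : Fin size → Fin m
    embed-∈         : ∀ j → P (embed j)
    embed-injective : Injective _≡_ _≡_ embed
    index           : ∀ {i} → P i → Fin size
    embed-index     : ∀ {i} (p : P i) → embed (index p) ≡ i

open Enumeration

module _ {P : Pred (Fin (suc m)) ℓ} where

  include-zero : P zero → Enumeration (P ∘ suc) → Enumeration P
  include-zero p₀ E .size = suc (E .size)
  include-zero p₀ E .embed zero = zero
  include-zero p₀ E .embed (suc j) = suc (E .embed j)
  include-zero p₀ E .embed-∈ zero = p₀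
  include-zero p₀ E .embed-∈ (suc j) = E .embed-∈ j
  include-zero p₀ E .embed-injective {zero} {zero} _ = refl
  include-zero p₀ E .embed-injective {suc i} {suc j} eq =
    cong suc (E .embed-injective (suc-injective eq))
  include-zero p₀ E .index {zero} _ = zero
  include-zero p₀ E .index {suc i} p = suc (E .index p)
  include-zero p₀ E .embed-index {zero} _ = refl
  include-zero p₀ E .embed-index {suc i} p = cong suc (E .embed-index p)

  exclude-zero : ¬ P zero → Enumeration (P ∘ suc) → Enumeration P
  exclude-zero ¬p₀ E .size = E .size
  exclude-zero ¬p₀ E .embed = suc ∘ E .embed
  exclude-zero ¬p₀ E .embed-∈ = E .embed-∈
  exclude-zero ¬p₀ E .embed-injective = E .embed-injective ∘ suc-injective
  exclude-zero ¬p₀ E .index {zero} p₀ = ⊥-elim (¬p₀ p₀)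
  exclude-zero ¬p₀ E .index {suc i} p = E .index p
  exclude-zero ¬p₀ E .embed-index {zero} p₀ = ⊥-elim (¬p₀ p₀)
  exclude-zero ¬p₀ E .embed-index {suc i} p = cong suc (E .embed-index p)

enumerate : {P : Pred (Fin m) ℓ} → Decidable P → Enumeration P
enumerate {m = zero} P? = record
  { size = 0 ; embed = λ () ; embed-∈ = λ () ; embed-injective = λ { {()} }
  ; index = λ { {()} } ; embed-index = λ { {()} } }
enumerate {m = suc m} P? with P? zero
... | yes p₀ = include-zero p₀ (enumerate (P? ∘ suc))
... | no ¬p₀ = exclude-zero ¬p₀ (enumerate (P? ∘ suc))

size+size≤ : {P Q : Pred (Fin m) ℓ} → P ⊥ Q →
             (E : Enumeration P) (F : Enumeration Q) → E .size + F .size ≤ m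
size+size≤ {Q = Q} P⊥Q E F = injective⇒≤ (splitAt-injective ∘ merge-injective)
  where
  merge : Fin (E .size) ⊎ Fin (F .size) → Fin _
  merge = [ E .embed , F .embed ]

  merge-injective : Injective _≡_ _≡_ merge
  merge-injective {inj₁ i} {inj₁ j} eq = cong inj₁ (E .embed-injective eq)
  merge-injective {inj₂ i} {inj₂ j} eq = cong inj₂ (F .embed-injective eq)
  merge-injective {inj₁ i} {inj₂ j} eq =
    ⊥-elim (P⊥Q (E .embed-∈ i , ≡.subst Q (≡.sym eq) (F .embed-∈ j)))
  merge-injective {inj₂ i} {inj₁ j} eq =
    ⊥-elim (P⊥Q (E .embed-∈ j , ≡.subst Q eq (F .embed-∈ i)))

  splitAt-injective : Injective _≡_ _≡_ (splitAt (E .size))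
  splitAt-injective = Injection.injective (↔⇒↣ +↔⊎)

private
  variable
    G : Graph

induced : (G : Graph) {X : Pred (Fin (n G)) ℓ} → Decidable X → Graph
induced G X? = record
  { n      = E .size
  ; adj    = λ u v → adj G (E .embed u) (E .embed v)
  ; sym    = λ u v → Graph.sym G (E .embed u) (E .embed v)
  ; irrefl = irrefl G ∘ E .embed
  }
  where E = enumerate X?

induced-adj : (G : Graph) {X : Pred (Fin (n G)) ℓ} (X? : Decidable X) {u v : Fin (n G)} →
              (xu : X u) (xv : X v) → adj G u v ≡ true →
              adj (induced G X?) (enumerate X? .index xu) (enumerate X? .index xv) ≡ true
induced-adj G X? xu xv = subst₂ (λ u v → adj G u v ≡ true)
  (≡.sym (enumerate X? .embed-index xu)) (≡.sym (enumerate X? .embed-index xv))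

restrict-biclique : {X : Pred (Fin (n G)) ℓ} (X? : Decidable X) → Biclique G → Biclique (induced G X?)
restrict-biclique X? β = record
  { A        = A β ∘ E .embed
  ; B        = B β ∘ E .embed
  ; complete = λ a b → complete β (E .embed a) (E .embed b)
  }
  where E = enumerate X?

restrict : {X : Pred (Fin (n G)) ℓ} {c : ℕ} (P : BicliquePartition G m) (X? : Decidable X)
           (ι : Fin c → Fin m) → Injective _≡_ _≡_ ι →
           (∀ {u v i} → X u → X v → Covers (bic P i) u v → ∃ λ j → ι j ≡ i) →
           BicliquePartition (induced G X?) c
restrict {G = G} {c = c} P X? ι ι-injective ι-covers = record
  { bic    = restrict-biclique X? ∘ bic P ∘ ι
  ; cover  = cover′
  ; unique = λ u v i j cᵢ cⱼ → ι-injective (unique P (E .embed u) (E .embed v) (ι i) (ι j) cᵢ cⱼ)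
  }
  where
  E = enumerate X?

  cover′ : ∀ u v → adj (induced G X?) u v ≡ true →
           ∃ λ (j : Fin c) → Covers (restrict-biclique X? (bic P (ι j))) u v
  cover′ u v uv with cover P (E .embed u) (E .embed v) uv
  ... | i , cv with ι-covers (E .embed-∈ u) (E .embed-∈ v) cv
  ...   | j , refl = j , cv

Side : (Fin m → Bool) → Pred (Fin m) 0ℓ
Side s i = s i ≡ true

side? : (s : Fin m → Bool) → Decidable (Side s)
side? s i = s i ≟ᵇ true

Independent : Biclique G → Pred (Fin (n G)) ℓ → Set ℓ
Independent β X = ∀ {u v} → Covers β u v → ¬ (X u × X v)

Spans : Biclique G → Pred (Fin (n G)) ℓ → Set ℓ
Spans β X = (X ≬ Side (A β)) × (X ≬ Side (B β))

spans? : {X : Pred (Fin (n G)) ℓ} (β : Biclique G) → Decidable X → Dec (Spans β X)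
spans? β X? = any? (X? ∩? side? (A β)) ×-dec any? (X? ∩? side? (B β))

covers⇒spans : {X : Pred (Fin (n G)) ℓ} (β : Biclique G) {u v : Fin (n G)} →
               Covers β u v → X u → X v → Spans β X
covers⇒spans β {u} {v} (inj₁ (au , bv)) xu xv = (u , xu , au) , (v , xv , bv)
covers⇒spans β {u} {v} (inj₂ (av , bu)) xu xv = (v , xv , av) , (u , xu , bu)

spans-sides⇒≡ : (P : BicliquePartition G m) {i j : Fin m} →
                Spans (bic P i) (Side (A (bic P j))) → Spans (bic P i) (Side (B (bic P j))) → i ≡ j
spans-sides⇒≡ P {i} {j} ((u , aⱼu , aᵢu) , _) (_ , (v , bⱼv , bᵢv)) =
  unique P u v i j (inj₁ (aᵢu , bᵢv)) (inj₁ (aⱼu , bⱼv))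

no-loop : (G : Graph) (v : Fin (n G)) → adj G v v ≢ true
no-loop G v vv with ≡.trans (≡.sym vv) (irrefl G v)
... | ()

sides-disjoint : (β : Biclique G) {v : Fin (n G)} → A β v ≡ true → B β v ≢ true
sides-disjoint {G = G} β {v} av bv = no-loop G v (complete β v v av bv)

A-independent : (β : Biclique G) → Independent β (Side (A β))
A-independent β (inj₁ (_ , bv)) (_ , av) = sides-disjoint β av bv
A-independent β (inj₂ (_ , bu)) (au , _) = sides-disjoint β au bu

B-independent : (β : Biclique G) → Independent β (Side (B β))
B-independent β (inj₁ (au , _)) (bu , _) = sides-disjoint β au bu
B-independent β (inj₂ (av , _)) (_ , bv) = sides-disjoint β av bv

∁A-independent : (β : Biclique G) → Independent β (∁ (Side (A β)))
∁A-independent β (inj₁ (au , _)) (¬au , _) = ¬au au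
∁A-independent β (inj₂ (av , _)) (_ , ¬av) = ¬av av

∁B-independent : (β : Biclique G) → Independent β (∁ (Side (B β)))
∁B-independent β (inj₁ (_ , bv)) (_ , ¬bv) = ¬bv bv
∁B-independent β (inj₂ (_ , bu)) (¬bu , _) = ¬bu bu

module SplitAlong (P : BicliquePartition G (suc m)) {X : Pred (Fin (n G)) ℓ} (X? : Decidable X)
                  (X-independent : Independent (bic P zero) X)
                  (∁X-independent : Independent (bic P zero) (∁ X)) where

  spanning : Enumeration (λ i → Spans (bic P (suc i)) X)
  spanning = enumerate (λ i → spans? (bic P (suc i)) X?)

  partition : BicliquePartition (induced G X?) (spanning .size)
  partition = restrict P X? (suc ∘ spanning .embed) (spanning .embed-injective ∘ suc-injective) covered
    where
    covered : ∀ {u v i} → X u → X v → Covers (bic P i) u v → ∃ λ j → suc (spanning .embed j) ≡ i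
    covered {i = zero}  xu xv cv = ⊥-elim (X-independent cv (xu , xv))
    covered {i = suc i} xu xv cv =
      _ , cong suc (spanning .embed-index (covers⇒spans (bic P (suc i)) cv xu xv))

  partition-∁ : BicliquePartition (induced G (∁? X?)) m
  partition-∁ = restrict P (∁? X?) suc suc-injective covered
    where
    covered : ∀ {u v i} → ∁ X u → ∁ X v → Covers (bic P i) u v → ∃ λ j → suc j ≡ i
    covered {i = zero}  ¬xu ¬xv cv = ⊥-elim (∁X-independent cv (¬xu , ¬xv))
    covered {i = suc i} _   _   _  = i , refl

restrict-all : {X : Pred (Fin (n G)) ℓ} (P : BicliquePartition G m) (X? : Decidable X) →
               BicliquePartition (induced G X?) m
restrict-all P X? = restrict P X? id id (λ {_} {_} {i} _ _ _ → i , refl)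

HasSplit : Graph → ℕ → ℕ → Set₁
HasSplit G k₁ k₂ = ∃₂ λ (X : Pred (Fin (n G)) 0ℓ) (X? : Decidable X) →
  HasPartitionAtMost (induced G X?) k₁ × HasPartitionAtMost (induced G (∁? X?)) k₂

halving : ∀ {k} → HasPartitionAtMost G (suc k) → HasSplit G (k / 2) k
halving (zero , _ , P) = ∅ , ∅? , (0 , z≤n , restrict-all P ∅?) , (0 , z≤n , restrict-all P (∁? ∅?))
halving {G = G} {k} (suc m , s≤s m≤k , P) =
  choose-side (x+y≤k⇒x≤k/2⊎y≤k/2 (≤-trans (size+size≤ disjoint SA.spanning SB.spanning) m≤k))
  where
  β₀ : Biclique G
  β₀ = bic P zero

  module SA = SplitAlong P (side? (A β₀)) (A-independent β₀) (∁A-independent β₀)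
  module SB = SplitAlong P (side? (B β₀)) (B-independent β₀) (∁B-independent β₀)

  disjoint : (λ i → Spans (bic P (suc i)) (Side (A β₀))) ⊥ (λ i → Spans (bic P (suc i)) (Side (B β₀)))
  disjoint (spans-A₀ , spans-B₀) = 0≢1+n (≡.sym (spans-sides⇒≡ P spans-A₀ spans-B₀))

  choose-side : SA.spanning .size ≤ k / 2 ⊎ SB.spanning .size ≤ k / 2 → HasSplit G (k / 2) k
  choose-side (inj₁ ≤k/2) = _ , side? (A β₀) , (_ , ≤k/2 , SA.partition) , (m , m≤k , SA.partition-∁)
  choose-side (inj₂ ≤k/2) = _ , side? (B β₀) , (_ , ≤k/2 , SB.partition) , (m , m≤k , SB.partition-∁)

colorable-identity : (G : Graph) → Colorable G (n G)
colorable-identity G = id , proper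
  where
  proper : ∀ u v → adj G u v ≡ true → u ≢ v
  proper u _ uu refl = no-loop G u uu

colorable-weaken : ∀ {c d} → c ≤ d → Colorable G c → Colorable G d
colorable-weaken c≤d (col , proper) =
  (λ v → inject≤ (col v) c≤d) , λ u v uv → proper u v uv ∘ inject≤-injective c≤d c≤d _ _

colorable-split : {X : Pred (Fin (n G)) ℓ} (X? : Decidable X) {a b : ℕ} →
                  Colorable (induced G (∁? X?)) a → Colorable (induced G X?) b → Colorable G (a + b)
colorable-split {G = G} X? {a} {b} (col∁ , proper∁) (colX , properX) =
  join a b ∘ colour , λ u v uv → proper u v uv ∘ join-injective
  where
  join-injective : Injective _≡_ _≡_ (join a b)
  join-injective = Injection.injective (↔⇒↣ (↔-sym +↔⊎))

  colour : Fin (n G) → Fin a ⊎ Fin b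
  colour v with X? v
  ... | yes xv = inj₂ (colX (enumerate X? .index xv))
  ... | no ¬xv = inj₁ (col∁ (enumerate (∁? X?) .index ¬xv))

  proper : ∀ u v → adj G u v ≡ true → colour u ≢ colour v
  proper u v uv with X? u | X? v
  ... | yes xu  | yes xv  = properX _ _ (induced-adj G X? xu xv uv) ∘ inj₂-injective
  ... | no ¬xu  | no ¬xv  = proper∁ _ _ (induced-adj G (∁? X?) ¬xu ¬xv uv) ∘ inj₁-injective
  ... | yes _   | no _    = λ ()
  ... | no _    | yes _   = λ ()

-- Colorability is not decided here, so χ(G) exists only up to double negation; this is enough
-- because the goal c ≤ a + b is decidable.
¬¬-chromaticNumber : (G : Graph) → ¬ ¬ ∃ (IsChromaticNumber G)
¬¬-chromaticNumber G = ¬¬-least (colorable-identity G)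

IsF⇒¬¬colorable : ∀ {k a} → IsF k a → HasPartitionAtMost G k → ¬ ¬ Colorable G a
IsF⇒¬¬colorable {G = G} (_ , maximal) G-partition ¬colorable =
  ¬¬-chromaticNumber G λ (χ , χ-colorable , χ-least) →
    ¬colorable (colorable-weaken {G = G} (maximal G G-partition χ (χ-colorable , χ-least)) χ-colorable)

proposition2 : ∀ (k a b c : ℕ) → IsF k a → IsF (k / 2) b → IsF (suc k) c →
    c ≤ a + b
proposition2 k a b c f[k]≡a f[k/2]≡b ((G , G-partition , χ[G]≡c) , _) =
  decidable-stable (c ≤? a + b) λ c≰a+b →
    let (X , X? , X-partition , ∁X-partition) = halving G-partition in
    IsF⇒¬¬colorable f[k]≡a ∁X-partition λ ∁X-colorable →
    IsF⇒¬¬colorable f[k/2]≡b X-partition λ X-colorable →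
    c≰a+b (proj₂ χ[G]≡c (a + b) (colorable-split {G = G} X? ∁X-colorable X-colorable))
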